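{- Let $G$ be a finite simple graph with vertex set $[n]$ and no 3-cycles, with edges ordered lexicographically. If the vertex labeling is a quasi-perfect ordering, then the set of tight spanning forests of $G$ equals the set of NBC sets of $G$.
   Context: A sequence of distinct integers is tight if it has no subsequence in the same relative order as $231$, $312$ or $321$. A labeled forest, with each component rooted at its smallest vertex, is tight if every path starting at a root has a tight label sequence; a tight spanning forest of $G$ is an edge set forming a tight forest. Edges $ij$ ($i<j$) are ordered lexicographically; a broken circuit is a cycle's edge set minus its smallest edge; an NBC set contains no broken circuit. A candidate path is a path $a,c,b,v_1,\dots,v_m=d$ with $a<b<c$, $m\ge1$, and $v_m$ the only $v_i$ smaller than $c$; the labeling is a quasi-perfect ordering if every candidate path satisfies: either $ad\in E(G)$, or else $d<b$ and $cd\in E(G)$. -}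

module Defs where

open import Data.Bool using (Bool; true; false; T; if_then_else_)
open import Data.Nat using (ℕ)
open import Data.Fin using (Fin; _<_; _≤_; _≤?_)
open import Data.List using (List; []; _∷_; _++_; [_]; length; lookup; map)
open import Data.List.Relation.Unary.Linked using (Linked)
open import Data.List.Relation.Unary.All using (All)
open import Data.List.Relation.Unary.Unique.Propositional using (Unique)
open import Data.List.Membership.Propositional using (_∈_)
open import Data.Product using (Σ; ∃; ∃-syntax; _×_; _,_; proj₁; proj₂)
open import Data.Sum using (_⊎_)
open import Data.Empty using (⊥)
open import Relation.Nullary using (¬_; does)
open import Relation.Binary.PropositionalEquality using (_≡_; _≢_)
open import Relation.Binary.Construct.Closure.ReflexiveTransitive using (Star)
open import Function.Bundles using (_⇔_)

-- A set of (undirected) edges on vertex set [n] = Fin n, given by its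
-- (intended symmetric) characteristic function.
EdgeSet : ℕ → Set
EdgeSet n = Fin n → Fin n → Bool

Edge : ∀ {n} → EdgeSet n → Fin n → Fin n → Set
Edge E i j = T (E i j)

record SimpleGraph (n : ℕ) : Set where
  field
    adj    : EdgeSet n
    sym    : ∀ i j → adj i j ≡ adj j i
    irrefl : ∀ i → adj i i ≡ false
open SimpleGraph public

module _ {n : ℕ} where

  Has231 Has312 Has321 : List (Fin n) → Set
  Has231 xs = ∃[ i ] ∃[ j ] ∃[ k ] (i < j × j < k ×
    lookup xs k < lookup xs i × lookup xs i < lookup xs j)
  Has312 xs = ∃[ i ] ∃[ j ] ∃[ k ] (i < j × j < k ×
    lookup xs j < lookup xs k × lookup xs k < lookup xs i)
  Has321 xs = ∃[ i ] ∃[ j ] ∃[ k ] (i < j × j < k ×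
    lookup xs k < lookup xs j × lookup xs j < lookup xs i)

  Tight : List (Fin n) → Set
  Tight xs = ¬ Has231 xs × ¬ Has312 xs × ¬ Has321 xs

  IsPath : (Fin n → Fin n → Set) → List (Fin n) → Set
  IsPath R vs = Unique vs × Linked R vs

  IsCycle : (Fin n → Fin n → Set) → Fin n → List (Fin n) → Set
  IsCycle R v ws = Unique (v ∷ ws) × 2 Data.Nat.≤ length ws × Linked R (v ∷ ws ++ [ v ])

  Acyclic : (Fin n → Fin n → Set) → Set
  Acyclic R = ∀ v ws → ¬ IsCycle R v ws

  IsRoot : EdgeSet n → Fin n → Set
  IsRoot F r = ∀ v → Star (Edge F) r v → r ≤ v

  TightForest : EdgeSet n → Set
  TightForest F = Acyclic (Edge F) ×
    (∀ r vs → IsRoot F r → IsPath (Edge F) (r ∷ vs) → Tight (r ∷ vs))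

  norm : Fin n × Fin n → Fin n × Fin n
  norm (i , j) = if does (i ≤? j) then (i , j) else (j , i)

  steps : List (Fin n) → List (Fin n × Fin n)
  steps [] = []
  steps (x ∷ []) = []
  steps (x ∷ y ∷ xs) = (x , y) ∷ steps (y ∷ xs)

  cycleEdges : Fin n → List (Fin n) → List (Fin n × Fin n)
  cycleEdges v ws = map norm (steps (v ∷ ws ++ [ v ]))

  LexLt : Fin n × Fin n → Fin n × Fin n → Set
  LexLt (a , b) (c , d) = a < c ⊎ (a ≡ c × b < d)

  IsMinEdge : Fin n × Fin n → List (Fin n × Fin n) → Set
  IsMinEdge e es = e ∈ es × All (λ f → f ≡ e ⊎ LexLt e f) es

  ContainsBrokenCircuit : SimpleGraph n → EdgeSet n → Set
  ContainsBrokenCircuit G F = ∃[ v ] ∃[ ws ] ∃[ e ]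
    (IsCycle (Edge (adj G)) v ws × IsMinEdge e (cycleEdges v ws) ×
     All (λ f → f ≢ e → Edge F (proj₁ f) (proj₂ f)) (cycleEdges v ws))

  NBC : SimpleGraph n → EdgeSet n → Set
  NBC G F = ¬ ContainsBrokenCircuit G F

  TriangleFree : SimpleGraph n → Set
  TriangleFree G = ∀ i j k → Edge (adj G) i j → Edge (adj G) j k → Edge (adj G) i k → ⊥

  -- candidate path a, c, b, u₁, …, u_{m-1}, d  (v_m = d)
  QuasiPerfect : SimpleGraph n → Set
  QuasiPerfect G = ∀ a c b (us : List (Fin n)) d →
    a < b → b < c → All (λ u → ¬ u < c) us → d < c →
    IsPath (Edge (adj G)) (a ∷ c ∷ b ∷ us ++ [ d ]) →
    Edge (adj G) a d ⊎ (d < b × Edge (adj G) c d)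

  IsEdgeSubset : SimpleGraph n → EdgeSet n → Set
  IsEdgeSubset G F = (∀ i j → F i j ≡ F j i) × (∀ i j → Edge F i j → Edge (adj G) i j)

module Submission where

-- A far descent in a sequence is an entry exceeding some entry two or more places later; for distinct
-- entries, avoiding 231, 312 and 321 means exactly having no far descent.
--
-- NBC ⇒ tight. A cycle of F would contain its own broken circuit. Read from its far end, a root path of F
-- must decrease strictly between entries two or more apart: a violation at the newest vertex exhibits in F
-- a candidate path with m = 1 or m = 2, and quasi-perfectness closes it into a triangle or into a cycle
-- whose least edge is its closing edge, so that F contains a broken circuit.
--
-- Tight ⇒ NBC. Let xy (x < y) be the least edge of a cycle whose other edges lie in F. Removing xy leaves
-- an F-path x, z, …, y whose vertices are all at least x, with y < z by minimality of xy and y at least two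
-- steps after z since there are no triangles. Take a path from the root of this component to the first
-- vertex t it shares with that path. If t is x or z, continuing towards y gives a root path with the far
-- descent z … y; otherwise continuing towards x gives one with the far descent t … z x.

open import Data.Bool using (T)
open import Data.Empty using (⊥; ⊥-elim)
open import Data.Fin using (Fin; zero; suc; _<_; _≤_; _≤?_)
open import Data.Fin.Induction using (<-wellFounded)
open import Data.Fin.Properties
  using (_≟_; <-cmp; <-trans; <-asym; <-irrefl; ≤∧≢⇒<; ≤-refl; ≤-trans; <-resp₂-≡)
open import Data.List
  using (List; []; _∷_; _++_; [_]; _∷ʳ_; length; lookup; map; reverse; drop; initLast; _∷ʳ′_)
open import Data.List.Properties using (unfold-reverse; reverse-++; map-++; ++-assoc; ∷-injectiveˡ; ∷-injectiveʳ)
open import Data.List.Membership.Propositional using (_∈_; _∉_)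
open import Data.List.Membership.Propositional.Properties using (∈-lookup; ∈-∃++; ∈-++⁺ˡ; ∈-++⁺ʳ; ∈-++⁻)
open import Data.List.Relation.Binary.Disjoint.Propositional using (Disjoint)
open import Data.List.Relation.Binary.Permutation.Propositional using (_↭_; ↭⇒↭ₛ)
import Data.List.Relation.Binary.Permutation.Propositional as ↭
open import Data.List.Relation.Binary.Permutation.Propositional.Properties
  using (↭-reverse; ↭-length; ∷↭∷ʳ; All-resp-↭)
import Data.List.Relation.Binary.Permutation.Setoid.Properties as ↭ₛ
open import Data.List.Relation.Binary.Sublist.Propositional as Sublist
  using (_⊆_; []; _∷_; minimum; from∈; to∈; ⊆-refl; ⊆-trans)
open import Data.List.Relation.Binary.Sublist.Propositional.Properties
  using (++⁺; ++⁺ˡ; ++⁺ʳ; ∷ˡ⁻; reverse⁺; All-resp-⊆)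
open import Data.List.Relation.Unary.All using (All; []; _∷_)
import Data.List.Relation.Unary.All as All
import Data.List.Relation.Unary.All.Properties as All
open import Data.List.Relation.Unary.AllPairs using ([]; _∷_)
open import Data.List.Relation.Unary.Any using (Any; here; there)
import Data.List.Relation.Unary.Any as Any
import Data.List.Relation.Unary.Any.Properties as Any
open import Data.List.Relation.Unary.First using (FirstView)
import Data.List.Relation.Unary.First as First
import Data.List.Relation.Unary.First.Properties as First
open import Data.List.Relation.Unary.Linked using (Linked; []; [-]; _∷_)
import Data.List.Relation.Unary.Linked as Linked
open import Data.List.Relation.Unary.Unique.Propositional using (Unique)
open import Data.List.Relation.Unary.Unique.Propositional.Properties
  using (Unique[x∷xs]⇒x∉xs) renaming (++⁺ to Unique-++⁺)
open import Data.Nat using (ℕ; s≤s; z≤n) renaming (_≤_ to _≤ℕ_)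
import Data.Nat.Properties as ℕ
open import Data.Product using (∃-syntax; _×_; _,_; proj₁; proj₂; uncurry)
open import Data.Product.Relation.Binary.Lex.Strict using (×-transitive; ×-compare)
open import Data.Sum using (_⊎_; inj₁; inj₂)
import Data.Sum as Sum
open import Data.Unit using (⊤; tt)
open import Defs hiding (sym)
open import Function using (_∘_)
open import Function.Bundles using (_⇔_; mk⇔)
open import Induction.WellFounded using (Acc; acc)
open import Relation.Binary using (Symmetric; tri<; tri≈; tri>)
open import Relation.Binary.Construct.Closure.ReflexiveTransitive using (Star; ε; _◅_; _◅◅_)
import Relation.Binary.Construct.Closure.ReflexiveTransitive as Star
open import Relation.Binary.PropositionalEquality
  using (_≡_; _≢_; refl; sym; trans; cong; subst; setoid; isEquivalence; ≢-sym)
open import Relation.Nullary using (¬_; yes; no; contradiction)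
open import Relation.Nullary.Decidable using (dec-true; dec-false; toSum)

module _ {A : Set} where

  Linked-∷ʳ : {R : A → A → Set} {xs : List A} {a b : A} →
              Linked R (xs ∷ʳ a) → R a b → Linked R (xs ∷ʳ a ∷ʳ b)
  Linked-∷ʳ {xs = []} _ r = r ∷ [-]
  Linked-∷ʳ {xs = _ ∷ []} (r′ ∷ _) r = r′ ∷ r ∷ [-]
  Linked-∷ʳ {xs = _ ∷ y ∷ xs} (r′ ∷ l) r = r′ ∷ Linked-∷ʳ {xs = y ∷ xs} l r

  Linked-reverse : {R : A → A → Set} → Symmetric R → {xs : List A} → Linked R xs → Linked R (reverse xs)
  Linked-reverse sym-R {[]} _ = []
  Linked-reverse sym-R {x ∷ []} _ = [-]
  Linked-reverse {R} sym-R {x ∷ y ∷ xs} (r ∷ l) =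
    subst (Linked R) (sym reverse≡)
      (Linked-∷ʳ (subst (Linked R) (unfold-reverse y xs) (Linked-reverse sym-R l)) (sym-R r))
    where
    reverse≡ : reverse (x ∷ y ∷ xs) ≡ reverse xs ∷ʳ y ∷ʳ x
    reverse≡ = trans (unfold-reverse x (y ∷ xs)) (cong (_∷ʳ x) (unfold-reverse y xs))

  Linked-++⁻ˡ : {R : A → A → Set} (xs : List A) {ys : List A} → Linked R (xs ++ ys) → Linked R xs
  Linked-++⁻ˡ [] _ = []
  Linked-++⁻ˡ (x ∷ []) _ = [-]
  Linked-++⁻ˡ (x ∷ y ∷ xs) (r ∷ l) = r ∷ Linked-++⁻ˡ (y ∷ xs) l

  Linked-++⁻ʳ : {R : A → A → Set} (xs : List A) {ys : List A} → Linked R (xs ++ ys) → Linked R ys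
  Linked-++⁻ʳ [] l = l
  Linked-++⁻ʳ (x ∷ []) {[]} _ = []
  Linked-++⁻ʳ (x ∷ []) {y ∷ ys} (_ ∷ l) = l
  Linked-++⁻ʳ (x ∷ y ∷ xs) (_ ∷ l) = Linked-++⁻ʳ (y ∷ xs) l

  Linked-join : {R : A → A → Set} (xs : List A) {t : A} {ys : List A} →
                Linked R (xs ∷ʳ t) → Linked R (t ∷ ys) → Linked R (xs ++ t ∷ ys)
  Linked-join [] _ l = l
  Linked-join (x ∷ []) (r ∷ _) l = r ∷ l
  Linked-join (x ∷ y ∷ xs) (r ∷ l′) l = r ∷ Linked-join (y ∷ xs) l′ l

  Linked⇒All-Star : {R : A → A → Set} {x : A} {xs : List A} → Linked R (x ∷ xs) → All (Star R x) (x ∷ xs)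
  Linked⇒All-Star [-] = ε ∷ []
  Linked⇒All-Star (r ∷ l) = ε ∷ All.map (r ◅_) (Linked⇒All-Star l)

  Unique-↭ : {xs ys : List A} → xs ↭ ys → Unique xs → Unique ys
  Unique-↭ p = ↭ₛ.Unique-resp-↭ (setoid A) (↭⇒↭ₛ p)

  Unique-reverse : {xs : List A} → Unique xs → Unique (reverse xs)
  Unique-reverse {xs} = Unique-↭ (↭.↭-sym (↭-reverse xs))

  All-reverse : {P : A → Set} {xs : List A} → All P xs → All P (reverse xs)
  All-reverse {xs = xs} = All-resp-↭ (↭.↭-sym (↭-reverse xs))

  Unique-⊆ : {xs ys : List A} → xs ⊆ ys → Unique ys → Unique xs
  Unique-⊆ [] _ = []
  Unique-⊆ (_ Sublist.∷ʳ σ) (_ ∷ u) = Unique-⊆ σ u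
  Unique-⊆ (refl ∷ σ) (x≢ys ∷ u) = All-resp-⊆ σ x≢ys ∷ Unique-⊆ σ u

  ⊆-index : {xs ys : List A} → xs ⊆ ys → Fin (length xs) → Fin (length ys)
  ⊆-index (_ Sublist.∷ʳ σ) i = suc (⊆-index σ i)
  ⊆-index (_ ∷ σ) zero = zero
  ⊆-index (_ ∷ σ) (suc i) = suc (⊆-index σ i)

  lookup-⊆-index : {xs ys : List A} (σ : xs ⊆ ys) (i : Fin (length xs)) →
                   lookup ys (⊆-index σ i) ≡ lookup xs i
  lookup-⊆-index (_ Sublist.∷ʳ σ) i = lookup-⊆-index σ i
  lookup-⊆-index (x≡y ∷ σ) zero = sym x≡y
  lookup-⊆-index (_ ∷ σ) (suc i) = lookup-⊆-index σ i

  ⊆-index-mono : {xs ys : List A} (σ : xs ⊆ ys) {i j : Fin (length xs)} → i < j → ⊆-index σ i < ⊆-index σ j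
  ⊆-index-mono (_ Sublist.∷ʳ σ) i<j = s≤s (⊆-index-mono σ i<j)
  ⊆-index-mono (_ ∷ σ) {zero} {suc j} _ = s≤s z≤n
  ⊆-index-mono (_ ∷ σ) {suc i} {suc j} (s≤s i<j) = s≤s (⊆-index-mono σ i<j)

  ⊆⇒lookups : {xs : List A} {a c b : A} → a ∷ c ∷ b ∷ [] ⊆ xs →
              ∃[ i ] ∃[ j ] ∃[ k ] i < j × j < k × lookup xs i ≡ a × lookup xs j ≡ c × lookup xs k ≡ b
  ⊆⇒lookups σ = ⊆-index σ zero , ⊆-index σ (suc zero) , ⊆-index σ (suc (suc zero)) ,
                ⊆-index-mono σ (s≤s z≤n) , ⊆-index-mono σ (s≤s (s≤s z≤n)) ,
                lookup-⊆-index σ zero , lookup-⊆-index σ (suc zero) , lookup-⊆-index σ (suc (suc zero))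

  lookup-⊆₂ : (xs : List A) {i j : Fin (length xs)} → i < j → lookup xs i ∷ lookup xs j ∷ [] ⊆ xs
  lookup-⊆₂ (x ∷ xs) {zero} {suc j} _ = refl ∷ from∈ (∈-lookup j)
  lookup-⊆₂ (x ∷ xs) {suc i} {suc j} (s≤s i<j) = x Sublist.∷ʳ lookup-⊆₂ xs i<j

  lookup-⊆₃ : (xs : List A) {i j k : Fin (length xs)} → i < j → j < k →
              lookup xs i ∷ lookup xs j ∷ lookup xs k ∷ [] ⊆ xs
  lookup-⊆₃ (x ∷ xs) {zero} {suc j} {suc k} _ (s≤s j<k) = refl ∷ lookup-⊆₂ xs j<k
  lookup-⊆₃ (x ∷ xs) {suc i} {suc j} {suc k} (s≤s i<j) (s≤s j<k) = x Sublist.∷ʳ lookup-⊆₃ xs i<j j<k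

module _ {n : ℕ} where

  module _ {R : Fin n → Fin n → Set} where

    IsPath-reverse : Symmetric R → {xs : List (Fin n)} → IsPath R xs → IsPath R (reverse xs)
    IsPath-reverse sym-R (u , l) = Unique-reverse u , Linked-reverse sym-R l

    IsPath-++⁻ˡ : (xs : List (Fin n)) {ys : List (Fin n)} → IsPath R (xs ++ ys) → IsPath R xs
    IsPath-++⁻ˡ xs (u , l) = Unique-⊆ (++⁺ʳ _ ⊆-refl) u , Linked-++⁻ˡ xs l

    IsPath-++⁻ʳ : (xs : List (Fin n)) {ys : List (Fin n)} → IsPath R (xs ++ ys) → IsPath R ys
    IsPath-++⁻ʳ xs (u , l) = Unique-⊆ (++⁺ˡ xs ⊆-refl) u , Linked-++⁻ʳ xs l

    IsPath-upTo : (xs : List (Fin n)) {t : Fin n} {ys : List (Fin n)} → IsPath R (xs ++ t ∷ ys) → IsPath R (xs ∷ʳ t)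
    IsPath-upTo xs {t} {ys} path = IsPath-++⁻ˡ (xs ∷ʳ t) (subst (IsPath R) (sym (++-assoc xs [ t ] ys)) path)

    IsPath-backFrom : Symmetric R → (xs : List (Fin n)) {t : Fin n} {ys : List (Fin n)} →
                      IsPath R (xs ++ t ∷ ys) → IsPath R (t ∷ reverse xs)
    IsPath-backFrom sym-R xs {t} path =
      subst (IsPath R) (reverse-++ xs [ t ]) (IsPath-reverse sym-R (IsPath-upTo xs path))

    IsPath-join : (xs : List (Fin n)) {t : Fin n} {ys zs : List (Fin n)} →
                  IsPath R (xs ++ t ∷ ys) → IsPath R (t ∷ zs) → Disjoint xs (t ∷ zs) → IsPath R (xs ++ t ∷ zs)
    IsPath-join xs path (u , l) disjoint =
      Unique-++⁺ (proj₁ (IsPath-++⁻ˡ xs path)) u disjoint , Linked-join xs (proj₂ (IsPath-upTo xs path)) l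

    -- A walk returning to r is cut at that return, keeping the side on which x lies.
    Star⇒IsPath : Symmetric R → {r x : Fin n} → Star R r x → ∃[ qs ] IsPath R (r ∷ qs) × x ∈ r ∷ qs
    Star⇒IsPath sym-R ε = [] , ([] ∷ [] , [-]) , here refl
    Star⇒IsPath sym-R {r} {x} (r~r₁ ◅ r₁⇝x) with Star⇒IsPath sym-R r₁⇝x
    ... | qs , path , x∈ with Any.any? (r ≟_) (_ ∷ qs)
    ...   | no r∉ = _ ∷ qs , (All.¬Any⇒All¬ _ r∉ ∷ proj₁ path , r~r₁ ∷ proj₂ path) , there x∈
    ...   | yes r∈ with ∈-∃++ r∈
    ...     | A , B , split with ∈-++⁻ A (subst (x ∈_) split x∈)
    ...       | inj₁ x∈A =
                reverse A , IsPath-backFrom sym-R A (subst (IsPath R) split path) , there (Any.reverse⁺ x∈A)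
    ...       | inj₂ x∈rB = B , IsPath-++⁻ʳ A (subst (IsPath R) split path) , x∈rB

  firstHit : (P : List (Fin n)) {ps : List (Fin n)} → Any (_∈ P) ps → FirstView (_∉ P) (_∈ P) ps
  firstHit P {ps} hit with First.first (λ v → Sum.swap (toSum (Any.any? (v ≟_) P))) ps
  ... | inj₁ first = First.toView first
  ... | inj₂ none = contradiction hit (All.All¬⇒¬Any none)

  -- Far descents

  NoFarDescent : List (Fin n) → Set
  NoFarDescent xs = ∀ {a c b} → a ∷ c ∷ b ∷ [] ⊆ xs → ¬ b < a

  noFarDescent-⊆ : {xs ys : List (Fin n)} → xs ⊆ ys → NoFarDescent ys → NoFarDescent xs
  noFarDescent-⊆ σ noDescent τ = noDescent (⊆-trans τ σ)

  noFarDescent⇒tight : {xs : List (Fin n)} → NoFarDescent xs → Tight xs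
  noFarDescent⇒tight {xs} noDescent =
      (λ (i , j , k , i<j , j<k , k<i , _) → noDescent (lookup-⊆₃ xs i<j j<k) k<i)
    , (λ (i , j , k , i<j , j<k , _ , k<i) → noDescent (lookup-⊆₃ xs i<j j<k) k<i)
    , (λ (i , j , k , i<j , j<k , k<j , j<i) → noDescent (lookup-⊆₃ xs i<j j<k) (<-trans k<j j<i))

  tight⇒noFarDescent : {xs : List (Fin n)} → Unique xs → Tight xs → NoFarDescent xs
  tight⇒noFarDescent {xs} u (no231 , no312 , no321) {a} {c} {b} σ b<a with ⊆⇒lookups σ | Unique-⊆ σ u
  ... | i , j , k , i<j , j<k , refl , refl , refl | (a≢c ∷ _ ∷ []) ∷ (c≢b ∷ []) ∷ [] ∷ [] with <-cmp a c
  ...   | tri< a<c _ _ = no231 (i , j , k , i<j , j<k , b<a , a<c)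
  ...   | tri≈ _ a≡c _ = contradiction a≡c a≢c
  ...   | tri> _ _ c<a with <-cmp c b
  ...     | tri< c<b _ _ = no312 (i , j , k , i<j , j<k , c<b , b<a)
  ...     | tri≈ _ c≡b _ = contradiction c≡b c≢b
  ...     | tri> _ _ b<c = no321 (i , j , k , i<j , j<k , b<c , c<a)

  FarDecreasing : List (Fin n) → Set
  FarDecreasing [] = ⊤
  FarDecreasing (x ∷ xs) = All (_< x) (drop 1 xs) × FarDecreasing xs

  farDecreasing-⊆ : {ys : List (Fin n)} {a c b : Fin n} → FarDecreasing ys → a ∷ c ∷ b ∷ [] ⊆ ys → b < a
  farDecreasing-⊆ (_ , decreasing) (_ Sublist.∷ʳ σ) = farDecreasing-⊆ decreasing σ
  farDecreasing-⊆ (below , _) (refl ∷ _ Sublist.∷ʳ σ) = All.lookup below (to∈ (∷ˡ⁻ σ))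
  farDecreasing-⊆ (below , _) (refl ∷ _ ∷ σ) = All.lookup below (to∈ σ)

  farDecreasing-reverse⇒noFarDescent : {xs : List (Fin n)} → FarDecreasing (reverse xs) → NoFarDescent xs
  farDecreasing-reverse⇒noFarDescent decreasing σ b<a = <-asym b<a (farDecreasing-⊆ decreasing (reverse⁺ σ))

  -- Normalised edges

  Pair : Set
  Pair = Fin n × Fin n

  norm-≤ : {i j : Fin n} → i ≤ j → norm (i , j) ≡ (i , j)
  norm-≤ {i} {j} i≤j rewrite dec-true (i ≤? j) i≤j = refl

  norm-> : {i j : Fin n} → j < i → norm (i , j) ≡ (j , i)
  norm-> {i} {j} j<i rewrite dec-false (i ≤? j) (ℕ.<⇒≱ j<i) = refl

  norm-cases : (i j : Fin n) → norm (i , j) ≡ (i , j) ⊎ norm (i , j) ≡ (j , i)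
  norm-cases i j with i ≤? j
  ... | yes i≤j = inj₁ (norm-≤ i≤j)
  ... | no i≰j = inj₂ (norm-> (ℕ.≰⇒> i≰j))

  norm-comm : (i j : Fin n) → norm (i , j) ≡ norm (j , i)
  norm-comm i j with <-cmp i j
  ... | tri< i<j _ _ = trans (norm-≤ (ℕ.<⇒≤ i<j)) (sym (norm-> i<j))
  ... | tri≈ _ refl _ = refl
  ... | tri> _ _ j<i = trans (norm-> j<i) (sym (norm-≤ (ℕ.<⇒≤ j<i)))

  norm-endpoint : {a b h w : Fin n} → norm (a , b) ≡ norm (h , w) → a ≡ h ⊎ a ≡ w
  norm-endpoint {a} {b} {h} {w} eq with norm-cases a b | norm-cases h w
  ... | inj₁ ab | inj₁ hw = inj₁ (cong proj₁ (trans (sym ab) (trans eq hw)))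
  ... | inj₁ ab | inj₂ wh = inj₂ (cong proj₁ (trans (sym ab) (trans eq wh)))
  ... | inj₂ ba | inj₁ hw = inj₂ (cong proj₂ (trans (sym ba) (trans eq hw)))
  ... | inj₂ ba | inj₂ wh = inj₁ (cong proj₂ (trans (sym ba) (trans eq wh)))

  norm≢ : {a b h w : Fin n} → a ≢ h → a ≢ w → norm (a , b) ≢ norm (h , w)
  norm≢ a≢h a≢w eq = Sum.[ a≢h , a≢w ] (norm-endpoint eq)

  SymmetricEdgeSet : EdgeSet n → Set
  SymmetricEdgeSet F = ∀ i j → F i j ≡ F j i

  Edge-sym : {F : EdgeSet n} → SymmetricEdgeSet F → Symmetric (Edge F)
  Edge-sym {F} F-sym {i} {j} = subst T (F-sym i j)

  EdgeRel : (Pair → Set) → Fin n → Fin n → Set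
  EdgeRel Q u v = Q (norm (u , v))

  EdgeRel-sym : {Q : Pair → Set} → Symmetric (EdgeRel Q)
  EdgeRel-sym {Q} {u} {v} = subst Q (norm-comm u v)

  module _ {F : EdgeSet n} (F-sym : SymmetricEdgeSet F) {u v : Fin n} where

    Edge⇒EdgeRel : Edge F u v → EdgeRel (uncurry (Edge F)) u v
    Edge⇒EdgeRel u~v with norm-cases u v
    ... | inj₁ eq rewrite eq = u~v
    ... | inj₂ eq rewrite eq = Edge-sym F-sym u~v

    EdgeRel⇒Edge : EdgeRel (uncurry (Edge F)) u v → Edge F u v
    EdgeRel⇒Edge u~v with norm-cases u v
    ... | inj₁ eq rewrite eq = u~v
    ... | inj₂ eq rewrite eq = Edge-sym F-sym u~v

  edges : List (Fin n) → List Pair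
  edges xs = map norm (steps xs)

  Linked⇒All-edges : {Q : Pair → Set} {xs : List (Fin n)} → Linked (EdgeRel Q) xs → All Q (edges xs)
  Linked⇒All-edges [] = []
  Linked⇒All-edges [-] = []
  Linked⇒All-edges (q ∷ l) = q ∷ Linked⇒All-edges l

  All-edges⇒Linked : {Q : Pair → Set} (xs : List (Fin n)) → All Q (edges xs) → Linked (EdgeRel Q) xs
  All-edges⇒Linked [] _ = []
  All-edges⇒Linked (x ∷ []) _ = [-]
  All-edges⇒Linked (x ∷ y ∷ xs) (q ∷ qs) = q ∷ All-edges⇒Linked (y ∷ xs) qs

  steps-∷ʳ : (xs : List (Fin n)) (a b : Fin n) → steps (xs ∷ʳ a ∷ʳ b) ≡ steps (xs ∷ʳ a) ∷ʳ (a , b)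
  steps-∷ʳ [] a b = refl
  steps-∷ʳ (x ∷ []) a b = refl
  steps-∷ʳ (x ∷ y ∷ xs) a b = cong ((x , y) ∷_) (steps-∷ʳ (y ∷ xs) a b)

  edges-∷ʳ : (xs : List (Fin n)) (a b : Fin n) → edges (xs ∷ʳ a ∷ʳ b) ≡ edges (xs ∷ʳ a) ∷ʳ norm (a , b)
  edges-∷ʳ xs a b = trans (cong (map norm) (steps-∷ʳ xs a b)) (map-++ norm (steps (xs ∷ʳ a)) _)

  edges-avoid : {h w : Fin n} (t : Fin n) (ts : List (Fin n)) → All (λ v → v ≢ h × v ≢ w) (t ∷ ts) →
                All (_≢ norm (h , w)) (edges (w ∷ t ∷ ts ∷ʳ h))
  edges-avoid {h} {w} t ts away@((t≢h , t≢w) ∷ _) = norm≢ t≢h t≢w ∘ trans (norm-comm t w) ∷ later t ts away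
    where
    later : ∀ t ts → All (λ v → v ≢ h × v ≢ w) (t ∷ ts) → All (_≢ norm (h , w)) (edges (t ∷ ts ∷ʳ h))
    later t [] ((t≢h , t≢w) ∷ []) = norm≢ t≢h t≢w ∷ []
    later t (t′ ∷ ts) ((t≢h , t≢w) ∷ away) = norm≢ t≢h t≢w ∷ later t′ ts away

  -- The lexicographic order on edges

  lexLt-trans : {e f g : Pair} → LexLt e f → LexLt f g → LexLt e g
  lexLt-trans = ×-transitive {_≈₁_ = _≡_} {_<₁_ = _<_} {_<₂_ = _<_} isEquivalence <-resp₂-≡ <-trans <-trans

  lexLt-cmp : (e f : Pair) → LexLt e f ⊎ e ≡ f ⊎ LexLt f e
  lexLt-cmp e f with ×-compare sym <-cmp <-cmp e f
  ... | tri< e<f _ _ = inj₁ e<f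
  ... | tri≈ _ (refl , refl) _ = inj₂ (inj₁ refl)
  ... | tri> _ _ f<e = inj₂ (inj₂ f<e)

  minimumEdge : (e : Pair) (es : List Pair) → ∃[ m ] IsMinEdge m (e ∷ es)
  minimumEdge e [] = e , here refl , inj₁ refl ∷ []
  minimumEdge e (f ∷ es) with minimumEdge f es
  ... | m , m∈ , m-min with lexLt-cmp e m
  ...   | inj₁ e<m =
          e , here refl , inj₁ refl ∷ All.map (Sum.[ (λ { refl → inj₂ e<m }) , inj₂ ∘ lexLt-trans e<m ]) m-min
  ...   | inj₂ (inj₁ refl) = e , here refl , inj₁ refl ∷ m-min
  ...   | inj₂ (inj₂ m<e) = m , there m∈ , inj₂ m<e ∷ m-min

  lexLt⇒≤ : {x y a b : Fin n} → LexLt (x , y) (a , b) → x ≤ a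
  lexLt⇒≤ (inj₁ x<a) = ℕ.<⇒≤ x<a
  lexLt⇒≤ (inj₂ (refl , _)) = ≤-refl

  lexLt-norm⇒≤ : {x y a b : Fin n} → LexLt (x , y) (norm (a , b)) → x ≤ a × x ≤ b
  lexLt-norm⇒≤ {a = a} {b} l with a ≤? b
  ... | yes a≤b rewrite norm-≤ a≤b = lexLt⇒≤ l , ≤-trans (lexLt⇒≤ l) a≤b
  ... | no a≰b rewrite norm-> (ℕ.≰⇒> a≰b) = ≤-trans (lexLt⇒≤ l) (ℕ.<⇒≤ (ℕ.≰⇒> a≰b)) , lexLt⇒≤ l

  lexLt-norm⇒< : {x y b : Fin n} → x ≢ b → LexLt (x , y) (norm (x , b)) → y < b
  lexLt-norm⇒< {x} {y} {b} x≢b l with x ≤? b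
  ... | yes x≤b rewrite norm-≤ x≤b = second l
    where
    second : LexLt (x , y) (x , b) → y < b
    second (inj₁ x<x) = contradiction x<x (<-irrefl refl)
    second (inj₂ (_ , y<b)) = y<b
  ... | no x≰b rewrite norm-> (ℕ.≰⇒> x≰b) = swapped l
    where
    swapped : LexLt (x , y) (b , x) → y < b
    swapped (inj₁ x<b) = contradiction (ℕ.≰⇒> x≰b) (<-asym x<b)
    swapped (inj₂ (x≡b , _)) = contradiction x≡b x≢b

  lexLt-norm-above : {p q u v : Fin n} → p < u → p < v → LexLt (p , q) (norm (u , v))
  lexLt-norm-above {u = u} {v} p<u p<v with norm-cases u v
  ... | inj₁ eq rewrite eq = inj₁ p<u
  ... | inj₂ eq rewrite eq = inj₁ p<v

  edges-above : {p q : Fin n} {xs : List (Fin n)} → All (p <_) xs → All (LexLt (p , q)) (edges xs)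
  edges-above [] = []
  edges-above (_ ∷ []) = []
  edges-above (p<x ∷ p<y ∷ p<xs) = lexLt-norm-above p<x p<y ∷ edges-above (p<y ∷ p<xs)

  Linked-above⇒≤ : {x y v : Fin n} {vs : List (Fin n)} → Linked (EdgeRel (LexLt (x , y))) (v ∷ vs) →
                   All (x ≤_) vs
  Linked-above⇒≤ [-] = []
  Linked-above⇒≤ {v = v} {w ∷ _} (above ∷ l) = proj₂ (lexLt-norm⇒≤ {a = v} {w} above) ∷ Linked-above⇒≤ l

  -- Cycles

  IsCycle-rotate : {R : Fin n → Fin n → Set} {h w : Fin n} {t : List (Fin n)} →
                   IsCycle R h (w ∷ t) → IsCycle R w (t ∷ʳ h)
  IsCycle-rotate {h = h} {w} {t} (u , length≥2 , h~w ∷ path) =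
    Unique-↭ (∷↭∷ʳ h (w ∷ t)) u ,
    subst (2 ≤ℕ_) (↭-length (∷↭∷ʳ h t)) length≥2 ,
    Linked-∷ʳ {xs = w ∷ t} path h~w

  rotateCycle : {R : Fin n → Fin n → Set} {v : Fin n} {ws : List (Fin n)} {e : Pair} →
                IsCycle R v ws → e ∈ cycleEdges v ws →
                ∃[ h ] ∃[ w ] ∃[ t ] IsCycle R h (w ∷ t) × e ≡ norm (h , w) × cycleEdges h (w ∷ t) ↭ cycleEdges v ws
  rotateCycle {R} {e = e} cycle e∈ with ∈-∃++ e∈
  ... | E₁ , E₂ , edges≡ = rotate E₁ cycle edges≡
    where
    rotate : ∀ E₁ {v ws E₂} → IsCycle R v ws → cycleEdges v ws ≡ E₁ ++ e ∷ E₂ →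
             ∃[ h ] ∃[ w ] ∃[ t ] IsCycle R h (w ∷ t) × e ≡ norm (h , w) × cycleEdges h (w ∷ t) ↭ cycleEdges v ws
    rotate _ {ws = []} (_ , () , _) _
    rotate [] {v} {w ∷ t} cycle edges≡ = v , w , t , cycle , sym (∷-injectiveˡ edges≡) , ↭.↭-refl
    rotate (_ ∷ E₁) {v} {w ∷ t} {E₂} cycle edges≡ with rotate E₁ (IsCycle-rotate cycle) rotated≡
      where
      rotated≡ : cycleEdges w (t ∷ʳ v) ≡ E₁ ++ e ∷ E₂ ∷ʳ norm (v , w)
      rotated≡ = trans (edges-∷ʳ (w ∷ t) v w)
                   (trans (cong (_∷ʳ norm (v , w)) (∷-injectiveʳ edges≡)) (++-assoc E₁ (e ∷ E₂) _))
    ... | h , w′ , t′ , cycle′ , e≡ , perm =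
          h , w′ , t′ , cycle′ , e≡ ,
          ↭.↭-trans perm (↭.↭-trans (↭.↭-reflexive (edges-∷ʳ (w ∷ t) v w)) (↭.↭-sym (∷↭∷ʳ _ _)))

module NBC⇒TightForest {n : ℕ} (G : SimpleGraph n) (triangleFree : TriangleFree G) (quasiPerfect : QuasiPerfect G)
                        (F : EdgeSet n) (F⊆G : IsEdgeSubset G F) (nbc : NBC G F) where

  F-sym : SymmetricEdgeSet F
  F-sym = proj₁ F⊆G

  F⇒G : {i j : Fin n} → Edge F i j → Edge (adj G) i j
  F⇒G = proj₂ F⊆G _ _

  G-flip : {i j : Fin n} → Edge (adj G) i j → Edge (adj G) j i
  G-flip = Edge-sym (SimpleGraph.sym G)

  IsPath-F⇒G : {xs : List (Fin n)} → IsPath (Edge F) xs → IsPath (Edge (adj G)) xs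
  IsPath-F⇒G (u , l) = u , Linked.map F⇒G l

  IsPath-F-reverse : {xs : List (Fin n)} → IsPath (Edge F) xs → IsPath (Edge F) (reverse xs)
  IsPath-F-reverse = IsPath-reverse (Edge-sym F-sym)

  edges-inF : {xs : List (Fin n)} {e : Pair} → Linked (Edge F) xs →
              All (λ f → f ≢ e → uncurry (Edge F) f) (edges xs)
  edges-inF l = All.map (λ f∈F _ → f∈F) (Linked⇒All-edges (Linked.map (Edge⇒EdgeRel F-sym) l))

  nbc⇒acyclic : Acyclic (Edge F)
  nbc⇒acyclic v [] (_ , () , _)
  nbc⇒acyclic v (w ∷ t) (u , length≥2 , cycle) with minimumEdge (norm (v , w)) (edges (w ∷ t ∷ʳ v))
  ... | e , e-min = nbc (v , w ∷ t , e , (u , length≥2 , Linked.map F⇒G cycle) , e-min , edges-inF cycle)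

  brokenCircuit-atLeastVertex : {p q s : Fin n} (rs : List (Fin n)) → IsPath (Edge F) (q ∷ rs ∷ʳ s ∷ʳ p) →
                                Edge (adj G) p q → All (p <_) (q ∷ rs ∷ʳ s) → q < s → ContainsBrokenCircuit G F
  brokenCircuit-atLeastVertex {p} {q} {s} rs (u , path) p~q p<qrss@(p<q ∷ _) q<s =
    p , q ∷ rs ∷ʳ s , (p , q) ,
    (Unique-↭ (↭.↭-sym (∷↭∷ʳ p (q ∷ rs ∷ʳ s))) u ,
     s≤s (subst (1 ≤ℕ_) (↭-length (∷↭∷ʳ s rs)) (s≤s z≤n)) ,
     p~q ∷ Linked.map F⇒G path) ,
    (here (sym pq≡) , inj₁ pq≡ ∷ subst (All _) (sym (edges-∷ʳ (q ∷ rs) s p)) (All.map inj₂ laterAbove)) ,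
    (λ pq≢ → contradiction pq≡ pq≢) ∷ edges-inF path
    where
    pq≡ : norm (p , q) ≡ (p , q)
    pq≡ = norm-≤ (ℕ.<⇒≤ p<q)
    laterAbove : All (LexLt (p , q)) (edges (q ∷ rs ∷ʳ s) ∷ʳ norm (s , p))
    laterAbove = All.++⁺ (edges-above p<qrss)
                         (subst (LexLt (p , q)) (sym (norm-> (<-trans p<q q<s))) (inj₂ (refl , q<s)) ∷ [])

  noCandidatePath₁ : {a b c d : Fin n} → a < b → b < c → d < c → ¬ IsPath (Edge F) (a ∷ c ∷ b ∷ d ∷ [])
  noCandidatePath₁ {a} {b} {c} {d} a<b b<c d<c path@(((_ ∷ _ ∷ a≢d ∷ []) ∷ _) , _ ∷ c~b ∷ b~d ∷ [-])
    with quasiPerfect a c b [] d a<b b<c [] d<c (IsPath-F⇒G path)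
  ... | inj₂ (_ , c~d) = triangleFree c b d (F⇒G c~b) (F⇒G b~d) c~d
  ... | inj₁ a~d with <-cmp a d
  ...   | tri< a<d _ _ =
          nbc (brokenCircuit-atLeastVertex (b ∷ []) (IsPath-F-reverse path) a~d
                 (a<d ∷ a<b ∷ <-trans a<b b<c ∷ []) d<c)
  ...   | tri≈ _ a≡d _ = a≢d a≡d
  ...   | tri> _ _ d<a =
          nbc (brokenCircuit-atLeastVertex (c ∷ []) path (G-flip a~d)
                 (d<a ∷ d<c ∷ <-trans d<a a<b ∷ []) a<b)

  noCandidatePath₂ : {a b c v d : Fin n} → a < b → b < c → c < v → d < c →
                     ¬ IsPath (Edge F) (a ∷ c ∷ b ∷ v ∷ d ∷ [])
  noCandidatePath₂ {a} {b} {c} {v} {d} a<b b<c c<v d<c path@(((_ ∷ _ ∷ _ ∷ a≢d ∷ []) ∷ _) , _)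
    with quasiPerfect a c b (v ∷ []) d a<b b<c (<-asym c<v ∷ []) d<c (IsPath-F⇒G path)
  ... | inj₂ (d<b , c~d) =
        nbc (brokenCircuit-atLeastVertex (b ∷ []) (IsPath-++⁻ʳ (a ∷ []) path) (G-flip c~d)
               (d<c ∷ d<b ∷ <-trans d<c c<v ∷ []) c<v)
  ... | inj₁ a~d with <-cmp a d
  ...   | tri< a<d _ _ =
          nbc (brokenCircuit-atLeastVertex (v ∷ b ∷ []) (IsPath-F-reverse path) a~d
                 (a<d ∷ <-trans (<-trans a<b b<c) c<v ∷ a<b ∷ <-trans a<b b<c ∷ []) d<c)
  ...   | tri≈ _ a≡d _ = a≢d a≡d
  ...   | tri> _ _ d<a =
          nbc (brokenCircuit-atLeastVertex (c ∷ b ∷ []) path (G-flip a~d)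
                 (d<a ∷ d<c ∷ <-trans d<a a<b ∷ <-trans d<c c<v ∷ []) (<-trans (<-trans a<b b<c) c<v))

  farDecreasing-step₂ : {y p₁ p₂ p₃ : Fin n} → IsPath (Edge F) (y ∷ p₁ ∷ p₂ ∷ p₃ ∷ []) → p₃ < p₁ → p₂ < y
  farDecreasing-step₂ {y} {p₁} {p₂} path@(((_ ∷ y≢p₂ ∷ _) ∷ (p₁≢p₂ ∷ _) ∷ _) , _) p₃<p₁ with <-cmp p₂ y
  ... | tri< p₂<y _ _ = p₂<y
  ... | tri≈ _ p₂≡y _ = contradiction (sym p₂≡y) y≢p₂
  ... | tri> _ _ y<p₂ with <-cmp p₁ p₂
  ...   | tri< p₁<p₂ _ _ = ⊥-elim (noCandidatePath₁ p₃<p₁ p₁<p₂ y<p₂ (IsPath-F-reverse path))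
  ...   | tri≈ _ p₁≡p₂ _ = contradiction p₁≡p₂ p₁≢p₂
  ...   | tri> _ _ p₂<p₁ = ⊥-elim (noCandidatePath₁ y<p₂ p₂<p₁ p₃<p₁ path)

  farDecreasing-step₃ : {y p₁ p₂ p₃ p₄ : Fin n} → IsPath (Edge F) (y ∷ p₁ ∷ p₂ ∷ p₃ ∷ p₄ ∷ []) →
                        p₂ < y → p₃ < p₁ → p₄ < p₂ → p₃ < y
  farDecreasing-step₃ {y} {p₃ = p₃} path@(((_ ∷ _ ∷ y≢p₃ ∷ _) ∷ _) , _) p₂<y p₃<p₁ p₄<p₂ with <-cmp p₃ y
  ... | tri< p₃<y _ _ = p₃<y
  ... | tri≈ _ p₃≡y _ = contradiction (sym p₃≡y) y≢p₃
  ... | tri> _ _ y<p₃ = ⊥-elim (noCandidatePath₂ p₄<p₂ (<-trans p₂<y y<p₃) p₃<p₁ y<p₃ (IsPath-F-reverse path))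

  farDecreasing-toLeast : (ys : List (Fin n)) {r : Fin n} → IsPath (Edge F) (ys ∷ʳ r) → All (r ≤_) ys →
                          FarDecreasing (ys ∷ʳ r)
  farDecreasing-toLeast [] _ _ = [] , tt
  farDecreasing-toLeast (y ∷ ys) path (r≤y ∷ r≤ys) = below ys path r≤y decreasing , decreasing
    where
    decreasing = farDecreasing-toLeast ys (IsPath-++⁻ʳ (y ∷ []) path) r≤ys

    least<head : ∀ zs {r} → IsPath (Edge F) (y ∷ zs ∷ʳ r) → r ≤ y → r < y
    least<head zs (u , _) r≤y = ≤∧≢⇒< r≤y λ { refl → Unique[x∷xs]⇒x∉xs u (∈-++⁺ʳ zs (here refl)) }

    below : ∀ zs {r} → IsPath (Edge F) (y ∷ zs ∷ʳ r) → r ≤ y → FarDecreasing (zs ∷ʳ r) →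
            All (_< y) (drop 1 (zs ∷ʳ r))
    below [] _ _ _ = []
    below (p₁ ∷ []) path r≤y _ = least<head (p₁ ∷ []) path r≤y ∷ []
    below (p₁ ∷ p₂ ∷ []) path r≤y ((r<p₁ ∷ []) , _) =
      farDecreasing-step₂ path r<p₁ ∷ least<head (p₁ ∷ p₂ ∷ []) path r≤y ∷ []
    below (p₁ ∷ p₂ ∷ p₃ ∷ zs) path _ ((p₃<p₁ ∷ _) , below-p₂ , _) =
      p₂<y ∷ p₃<y zs path below-p₂ ∷ All.map (λ q<p₂ → <-trans q<p₂ p₂<y) below-p₂
      where
      p₂<y = farDecreasing-step₂ (IsPath-++⁻ˡ (y ∷ p₁ ∷ p₂ ∷ p₃ ∷ []) path) p₃<p₁
      p₃<y : ∀ zs {r} → IsPath (Edge F) (y ∷ p₁ ∷ p₂ ∷ p₃ ∷ zs ∷ʳ r) → All (_< p₂) (zs ∷ʳ r) → p₃ < y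
      p₃<y [] path (r<p₂ ∷ []) = farDecreasing-step₃ path p₂<y p₃<p₁ r<p₂
      p₃<y (p₄ ∷ zs) path (p₄<p₂ ∷ _) =
        farDecreasing-step₃ (IsPath-++⁻ˡ (y ∷ p₁ ∷ p₂ ∷ p₃ ∷ p₄ ∷ []) path) p₂<y p₃<p₁ p₄<p₂

  rootPath-noFarDescent : {r : Fin n} {vs : List (Fin n)} → IsRoot F r → IsPath (Edge F) (r ∷ vs) →
                          NoFarDescent (r ∷ vs)
  rootPath-noFarDescent {r} {vs} root path =
    farDecreasing-reverse⇒noFarDescent (subst FarDecreasing (sym (unfold-reverse r vs))
      (farDecreasing-toLeast (reverse vs) (subst (IsPath (Edge F)) (unfold-reverse r vs) (IsPath-F-reverse path))
        (All-reverse (All.tail (All.map (root _) (Linked⇒All-Star (proj₂ path)))))))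

  nbc⇒tightForest : TightForest F
  nbc⇒tightForest = nbc⇒acyclic , λ r vs root path → noFarDescent⇒tight (rootPath-noFarDescent root path)

module TightForest⇒NBC {n : ℕ} (F : EdgeSet n) (F-sym : SymmetricEdgeSet F) (tight : TightForest F) where

  -- IsRoot is not decidable, so the least vertex of a component is only found under a double negation.
  rootExists : (x : Fin n) → ¬ ¬ (∃[ r ] IsRoot F r × Star (Edge F) r x)
  rootExists x = descend x (<-wellFounded x) ε
    where
    descend : (v : Fin n) → Acc _<_ v → Star (Edge F) v x → ¬ ¬ (∃[ r ] IsRoot F r × Star (Edge F) r x)
    descend v (acc smaller) v⇝x noRoot = noRoot (v , isRoot , v⇝x)
      where
      isRoot : IsRoot F v
      isRoot w v⇝w with v ≤? w
      ... | yes v≤w = v≤w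
      ... | no v≰w = ⊥-elim (descend w (smaller (ℕ.≰⇒> v≰w)) (Star.reverse (Edge-sym F-sym) v⇝w ◅◅ v⇝x) noRoot)

  StartsAtRoot : List (Fin n) → Set
  StartsAtRoot [] = ⊥
  StartsAtRoot (v ∷ _) = IsRoot F v

  StartsAtRoot-++ : (Q : List (Fin n)) {t : Fin n} {ys zs : List (Fin n)} →
                    StartsAtRoot (Q ++ t ∷ ys) → StartsAtRoot (Q ++ t ∷ zs)
  StartsAtRoot-++ [] root = root
  StartsAtRoot-++ (_ ∷ _) root = root

  rootPath-noFarDescent : {ps : List (Fin n)} → StartsAtRoot ps → IsPath (Edge F) ps → NoFarDescent ps
  rootPath-noFarDescent {r ∷ vs} root path = tight⇒noFarDescent (proj₁ path) (proj₂ tight r vs root path)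

  TightSplit : List (Fin n) → Set
  TightSplit P = ∃[ A ] ∃[ t ] ∃[ B ] P ≡ A ++ t ∷ B × NoFarDescent (t ∷ B) × NoFarDescent (t ∷ reverse A)

  -- Enter P from a root at its first vertex t on P; both ways along P from t extend that root path.
  ¬¬tightSplit : {P : List (Fin n)} {x : Fin n} → IsPath (Edge F) P → x ∈ P → ¬ ¬ TightSplit P
  ¬¬tightSplit {P} {x} pathP x∈P noSplit = rootExists x λ (r , root , r⇝x) →
    let (qs , pathQ , x∈Q) = Star⇒IsPath (Edge-sym F-sym) r⇝x
    in noSplit (enter (r ∷ qs) root pathQ (firstHit P (Any.map (λ { refl → x∈P }) x∈Q)))
    where
    enter : ∀ ps → StartsAtRoot ps → IsPath (Edge F) ps → FirstView (_∉ P) (_∈ P) ps → TightSplit P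
    enter _ root pathQ (First._++_∷_ {Q} {t} Q∉P t∈P _) with ∈-∃++ t∈P
    ... | A , B , split =
          A , t , B , split ,
          fromRoot B (IsPath-++⁻ʳ A pathP′) (subst (_ ∈_) (sym split) ∘ ∈-++⁺ʳ A) ,
          fromRoot (reverse A) (IsPath-backFrom (Edge-sym F-sym) A pathP′)
            λ { (here refl) → t∈P ; (there v∈A) → subst (_ ∈_) (sym split) (∈-++⁺ˡ (Any.reverse⁻ {xs = A} v∈A)) }
      where
      pathP′ = subst (IsPath (Edge F)) split pathP
      fromRoot : ∀ S → IsPath (Edge F) (t ∷ S) → (∀ {v} → v ∈ t ∷ S → v ∈ P) → NoFarDescent (t ∷ S)
      fromRoot S pathS S⊆P =
        noFarDescent-⊆ (++⁺ˡ Q ⊆-refl)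
          (rootPath-noFarDescent (StartsAtRoot-++ Q root)
            (IsPath-join Q pathQ pathS λ (v∈Q , v∈S) → All.lookup Q∉P v∈Q (S⊆P v∈S)))

  -- Entering at x or z leaves the descent z … c y; entering later returns through z to x < t.
  noTightSplit : {x z c y : Fin n} {ws : List (Fin n)} → Unique (x ∷ z ∷ ws) → All (x ≤_) ws →
                 c ∷ y ∷ [] ⊆ ws → y < z → ¬ TightSplit (x ∷ z ∷ ws)
  noTightSplit _ _ σ y<z ([] , _ , _ , refl , noDescent , _) = noDescent (_ Sublist.∷ʳ refl ∷ σ) y<z
  noTightSplit _ _ σ y<z (_ ∷ [] , _ , _ , refl , noDescent , _) = noDescent (refl ∷ σ) y<z
  noTightSplit (x≢ ∷ _) x≤ws _ _ (_ ∷ _ ∷ A , t , B , refl , _ , noDescent) =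
    noDescent (refl ∷ reverse⁺ (refl ∷ refl ∷ minimum A))
      (≤∧≢⇒< (All.lookup x≤ws (∈-++⁺ʳ A (here refl))) (All.lookup x≢ (there (∈-++⁺ʳ A (here refl)))))

  EdgeAbove : Pair → Pair → Set
  EdgeAbove e f = uncurry (Edge F) f × LexLt e f

  noPathAbove : {x y z c : Fin n} {ws : List (Fin n)} →
                IsPath (EdgeRel (EdgeAbove (x , y))) (x ∷ z ∷ ws) → c ∷ y ∷ [] ⊆ ws → ⊥
  noPathAbove (u@((x≢z ∷ _) ∷ _) , x~z ∷ l) σ =
    ¬¬tightSplit (u , Linked.map (EdgeRel⇒Edge F-sym ∘ proj₁) (x~z ∷ l)) (here refl)
      (noTightSplit u (Linked-above⇒≤ (Linked.map proj₂ l)) σ (lexLt-norm⇒< x≢z (proj₂ x~z)))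

  module _ (G : SimpleGraph n) (triangleFree : TriangleFree G) where

    BrokenAt : Pair → Pair → Set
    BrokenAt e f = (f ≡ e ⊎ LexLt e f) × (f ≢ e → uncurry (Edge F) f)

    cycle⇒pathAbove : {h w t₁ : Fin n} {ts : List (Fin n)} → IsCycle (Edge (adj G)) h (w ∷ t₁ ∷ ts) →
                      All (BrokenAt (norm (h , w))) (cycleEdges h (w ∷ t₁ ∷ ts)) →
                      IsPath (EdgeRel (EdgeAbove (norm (h , w)))) (w ∷ t₁ ∷ ts ∷ʳ h)
    cycle⇒pathAbove {h} {w} {t₁} {ts} (u@(h≢ ∷ w≢ ∷ _) , _) (_ ∷ later) =
      Unique-↭ (∷↭∷ʳ h (w ∷ t₁ ∷ ts)) u ,
      All-edges⇒Linked _ (All.zipWith above (later , edges-avoid t₁ ts away))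
      where
      away = All.zip (All.map ≢-sym (All.tail h≢) , All.map ≢-sym w≢)
      above : ∀ {f} → BrokenAt (norm (h , w)) f × f ≢ norm (h , w) → EdgeAbove (norm (h , w)) f
      above ((inj₁ f≡e , _) , f≢e) = contradiction f≡e f≢e
      above ((inj₂ e<f , inF) , f≢e) = inF f≢e , e<f

    ¬brokenAtFirstEdge : {h w : Fin n} {t : List (Fin n)} → IsCycle (Edge (adj G)) h (w ∷ t) →
                         ¬ All (BrokenAt (norm (h , w))) (cycleEdges h (w ∷ t))
    ¬brokenAtFirstEdge {t = t} _ _ with initLast t
    ¬brokenAtFirstEdge (_ , s≤s () , _) _ | []
    ¬brokenAtFirstEdge {h} {w} (_ , _ , h~w ∷ w~t₁ ∷ t₁~h ∷ [-]) _ | [] ∷ʳ′ t₁ =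
      triangleFree h w t₁ h~w w~t₁ (Edge-sym (SimpleGraph.sym G) t₁~h)
    ¬brokenAtFirstEdge {h} {w} cycle@(((h≢w ∷ _) ∷ _) , _) broken | (t₁ ∷ ts) ∷ʳ′ tₖ =
      orient (cycle⇒pathAbove cycle broken)
      where
      PathAbove : Pair → Set
      PathAbove e = IsPath (EdgeRel (EdgeAbove e)) (w ∷ t₁ ∷ ts ∷ʳ tₖ ∷ʳ h)

      reverse≡ : reverse (w ∷ t₁ ∷ ts ∷ʳ tₖ ∷ʳ h) ≡ h ∷ tₖ ∷ reverse (w ∷ t₁ ∷ ts)
      reverse≡ = trans (reverse-++ (w ∷ t₁ ∷ ts ∷ʳ tₖ) [ h ]) (cong (h ∷_) (reverse-++ (w ∷ t₁ ∷ ts) [ tₖ ]))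

      -- The path is walked from the smaller end of the least edge.
      orient : PathAbove (norm (h , w)) → ⊥
      orient path with <-cmp w h
      ... | tri< w<h _ _ =
            noPathAbove (subst PathAbove (norm-> w<h) path) (++⁺ {as = [ tₖ ]} (++⁺ˡ ts ⊆-refl) ⊆-refl)
      ... | tri≈ _ w≡h _ = contradiction (sym w≡h) h≢w
      ... | tri> _ _ h<w =
            noPathAbove
              (subst (IsPath _) reverse≡
                (IsPath-reverse (λ {u} {v} → EdgeRel-sym {Q = EdgeAbove (h , w)} {u} {v})
                  (subst PathAbove (norm-≤ (ℕ.<⇒≤ h<w)) path)))
              (reverse⁺ (refl ∷ refl ∷ minimum ts))

    tightForest⇒nbc : NBC G F
    tightForest⇒nbc (v , ws , e , cycle , (e∈ , e-min) , rest∈F) with rotateCycle cycle e∈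
    ... | h , w , t , cycle′ , refl , perm =
          ¬brokenAtFirstEdge cycle′ (All-resp-↭ (↭.↭-sym perm) (All.zip (e-min , rest∈F)))

mainTheorem17 : (n : ℕ) (G : SimpleGraph n) → TriangleFree G → QuasiPerfect G →
                (F : EdgeSet n) → IsEdgeSubset G F → (TightForest F ⇔ NBC G F)
mainTheorem17 n G triangleFree quasiPerfect F F⊆G = mk⇔
  (λ tight → TightForest⇒NBC.tightForest⇒nbc F (proj₁ F⊆G) tight G triangleFree)
  (λ nbc → NBC⇒TightForest.nbc⇒tightForest G triangleFree quasiPerfect F F⊆G nbc)
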